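{- Let $L$ be an oriented link diagram which is the union of two $2$-tangles $R$ and $T$, and let $L'$ be obtained from $L$ by a mutation of $R$, equipped with the induced orientation and the induced labelling of components. Then $f(L)=f(L')$, where for an oriented link $K$ with components labelled $1,\dots,N$, \[ f(K)=\sum_{E\subseteq\{2,\dots,N\}}\gamma^{\sum_{j\in E,\ k\in\{1,\dots,N\}\setminus E}\operatorname{lk}_K(j,k)}. \]
   Context: A $2$-tangle in a link diagram is a disc in the projection plane meeting the diagram transversally in four endpoints (two "upper" and two "lower"); $L=R\cup T$ means the diagram is the union of the tangle $R$ inside a disc and the tangle $T$ outside it, glued at the four endpoints. Mutation replaces $R$ by its rotation by $\pi$ about the axis in the projection plane that exchanges the two upper endpoints with each other and the two lower endpoints with each other. Induced orientation: if the two arcs of $R$ at its upper endpoints are both oriented into $R$ or both out of $R$, all orientations are kept; if one is oriented into and one out of $R$, the orientations of all strands of $R$ are reversed (strands of $T$ keep their orientations), so that every crossing has the same sign before and after mutation. The induced labelling labels each component of $L'$ by the label of the corresponding component(s) of $L$ via the strands of $T$ and the labelling of $R$. The sign of a crossing is $\pm1$ by the right-hand rule; $\operatorname{lk}_K(i,j)$ is the sum of the signs of all crossings between components $i$ and $j$. -}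

module Defs where

open import Data.Nat using (ℕ; zero; suc)
open import Data.Bool using (Bool; true; false; not; if_then_else_; _∧_; _∨_)
open import Data.Fin using (Fin; zero; suc)
open import Data.Fin.Properties using () renaming (_≟_ to _≟ᶠ_)
open import Data.Integer using (ℤ; +_; -_; _+_)
import Data.Integer.Properties as ℤP
open import Data.Vec using (Vec; []; _∷_)
open import Data.Product using (Σ; ∃; _×_; _,_)
open import Data.Sum using (_⊎_)
open import Relation.Nullary using (¬_)
open import Relation.Nullary.Decidable using (⌊_⌋)
open import Relation.Binary.PropositionalEquality using (_≡_)

-- A diagram has n crossings.  At every crossing there are two strands,
-- `over` and `under`; each strand has an incoming and an outgoing end.
-- The disc boundary meets the diagram in four points (Fin 4); points
-- 0,1 are the two upper endpoints, 2,3 the two lower endpoints.  Each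
-- boundary point is a degree-2 node with an incoming and an outgoing end.
-- Arcs of the diagram go from an outgoing end to an incoming end
-- (`next`, a bijection with inverse `prev`).  Crossingless closed
-- components not meeting the disc boundary are counted by ℓ.

data Strand : Set where
  over under : Strand

swapS : Strand → Strand
swapS over  = under
swapS under = over

data Out (n : ℕ) : Set where
  cOut : Fin n → Strand → Out n
  bOut : Fin 4 → Out n

data In (n : ℕ) : Set where
  cIn : Fin n → Strand → In n
  bIn : Fin 4 → In n

-- Side of an end: true = inside R, false = in T.
-- inward i = true means the strand at boundary point i is oriented into R
-- (so its outgoing half at that point lies in R, its incoming half in T).
sideOut : ∀ {n} → (Fin n → Bool) → (Fin 4 → Bool) → Out n → Bool
sideOut inR inw (cOut x s) = inR x
sideOut inR inw (bOut i)   = inw i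

sideIn : ∀ {n} → (Fin n → Bool) → (Fin 4 → Bool) → In n → Bool
sideIn inR inw (cIn x s) = inR x
sideIn inR inw (bIn i)   = not (inw i)

record Diagram (n ℓ : ℕ) : Set where
  field
    -- ccw x = true : going counterclockwise around crossing x, starting at
    -- the incoming end of the under strand, the next end is the outgoing
    -- end of the over strand (otherwise it is the incoming over end).
    ccw       : Fin n → Bool
    inR       : Fin n → Bool
    inward    : Fin 4 → Bool
    next      : Out n → In n
    prev      : In n → Out n
    prev-next : ∀ o → prev (next o) ≡ o
    next-prev : ∀ i → next (prev i) ≡ i
    -- arcs do not cross the disc boundary except at the four points
    sides     : ∀ o → sideIn inR inward (next o) ≡ sideOut inR inward o

open Diagram public

sign : ∀ {n ℓ} → Diagram n ℓ → Fin n → ℤ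
sign D x = if ccw D x then + 1 else - (+ 1)

cont : ∀ {n} → In n → Out n
cont (cIn x s) = cOut x s
cont (bIn i)   = bOut i

succA : ∀ {n ℓ} → Diagram n ℓ → Out n → Out n
succA D o = cont (next D o)

iter : ∀ {A : Set} → (A → A) → ℕ → A → A
iter f zero    a = a
iter f (suc k) a = f (iter f k a)

Reach : ∀ {n ℓ} → Diagram n ℓ → Out n → Out n → Set
Reach D o o' = ∃ λ k → iter (succA D) k o ≡ o'

-- Labelling of components by 1..N (here Fin N, label 1 = zero).

record Labelling {n ℓ : ℕ} (D : Diagram n ℓ) (N : ℕ) : Set where
  field
    lab      : Out n → Fin N
    loopLab  : Fin ℓ → Fin N
    lab-succ : ∀ o → lab (succA D o) ≡ lab o
    lab-comp : ∀ o o' → lab o ≡ lab o' → Reach D o o'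
    loop-inj : ∀ l l' → loopLab l ≡ loopLab l' → l ≡ l'
    loop-new : ∀ l o → ¬ (loopLab l ≡ lab o)
    onto     : ∀ j → (∃ λ o → lab o ≡ j) ⊎ (∃ λ l → loopLab l ≡ j)

open Labelling public

sumℤ : ∀ {m} → (Fin m → ℤ) → ℤ
sumℤ {zero}  g = + 0
sumℤ {suc m} g = g zero + sumℤ (λ i → g (suc i))

eqF : ∀ {N} → Fin N → Fin N → Bool
eqF a b = ⌊ a ≟ᶠ b ⌋

lk : ∀ {n ℓ N} (D : Diagram n ℓ) → Labelling D N → Fin N → Fin N → ℤ
lk D λ' i j = sumℤ (λ x →
  let a = lab λ' (cOut x over)
      b = lab λ' (cOut x under)
  in if (eqF a i ∧ eqF b j) ∨ (eqF a j ∧ eqF b i) then sign D x else + 0)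

member : ∀ {N} → Vec Bool N → Fin N → Bool
member (b ∷ _)  zero    = b
member (_ ∷ bs) (suc i) = member bs i

avoids1 : ∀ {N} → Vec Bool N → Bool
avoids1 []      = true
avoids1 (b ∷ _) = not b

cut : ∀ {n ℓ N} (D : Diagram n ℓ) → Labelling D N → Vec Bool N → ℤ
cut D λ' E = sumℤ (λ j → sumℤ (λ k →
  if member E j ∧ not (member E k) then lk D λ' j k else + 0))

-- Laurent polynomials in γ with integer coefficients, as coefficient functions.
LPoly : Set
LPoly = ℤ → ℤ

γ^_ : ℤ → LPoly
(γ^ k) m = if ⌊ m ℤP.≟ k ⌋ then + 1 else + 0

0ₚ : LPoly
0ₚ m = + 0

_+ₚ_ : LPoly → LPoly → LPoly
(p +ₚ q) m = p m + q m

sumSubsets : (N : ℕ) → (Vec Bool N → LPoly) → LPoly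
sumSubsets zero    g = g []
sumSubsets (suc N) g = sumSubsets N (λ E → g (true ∷ E)) +ₚ sumSubsets N (λ E → g (false ∷ E))

f : ∀ {n ℓ N} (D : Diagram n ℓ) → Labelling D N → LPoly
f {N = N} D λ' = sumSubsets N (λ E → if avoids1 E then γ^ (cut D λ' E) else 0ₚ)

σ : Fin 4 → Fin 4
σ zero                   = suc zero
σ (suc zero)             = zero
σ (suc (suc zero))       = suc (suc (suc zero))
σ (suc (suc (suc zero))) = suc (suc zero)

-- orientations of R are kept iff both upper arcs point into R or both out
keepOr : ∀ {n ℓ} → Diagram n ℓ → Bool
keepOr D = ⌊ Data.Bool._≟_ (inward D zero) (inward D (suc zero)) ⌋
  where import Data.Bool

ρOut : ∀ {n} → Out n → Out n
ρOut (cOut x s) = cOut x (swapS s)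
ρOut (bOut i)   = bOut (σ i)

ρIn : ∀ {n} → In n → In n
ρIn (cIn x s) = cIn x (swapS s)
ρIn (bIn i)   = bIn (σ i)

-- rotation together with reversal of orientation of R
flipOI : ∀ {n} → Out n → In n
flipOI (cOut x s) = cIn x (swapS s)
flipOI (bOut i)   = bIn (σ i)

mutNext : ∀ {n ℓ} → Diagram n ℓ → Out n → In n
mutNext D o =
  if sideOut (inR D) (inward D) o
  then (if keepOr D then ρIn (next D (ρOut o)) else flipOI (prev D (flipOI o)))
  else next D o

-- the arc of L corresponding to an arc of L' (identified by its start)
corr : ∀ {n ℓ} → Diagram n ℓ → Out n → Out n
corr D o =
  if sideOut (inR D) (inward D) o
  then (if keepOr D then ρOut o else prev D (flipOI o))
  else o

-- L' is obtained from L by mutation of R with the induced orientation.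
-- (Rotation reverses cyclic order and exchanges over/under; reversal of
-- both strands also preserves the handedness datum, so ccw is unchanged.)
record IsMutant {n ℓ} (L L' : Diagram n ℓ) : Set where
  field
    same-ccw    : ∀ x → ccw L' x ≡ ccw L x
    same-inR    : ∀ x → inR L' x ≡ inR L x
    same-inward : ∀ i → inward L' i ≡ inward L i
    arcs        : ∀ o → next L' o ≡ mutNext L o

-- induced labelling: every component of L' carries the label of a
-- corresponding component of L (one sharing a strand with it)
record Induced {n ℓ N} (L L' : Diagram n ℓ) (λ₁ : Labelling L N) (λ₂ : Labelling L' N) : Set where
  field
    ind-arc  : ∀ o → ∃ λ o' → Reach L' o o' × (lab λ₂ o ≡ lab λ₁ (corr L o'))
    ind-loop : ∀ l → loopLab λ₂ l ≡ loopLab λ₁ l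

-- A subset E of the labels is a 2-colouring of the components, and cut E is the sum of the
-- signs of the crossings between differently coloured strands.  E and its complement have the
-- same cut and exactly one of them avoids label 1, so 2 f is the sum of γ^cut over all
-- colourings, and it suffices to match the colourings of L and L′ by a cut-preserving bijection.
-- A colouring c of L is carried to L′ by keeping it on T and giving each end in R the colour of
-- the end that the rotation sends to it, complemented when the two upper endpoints have
-- different colours.  This is constant along the arcs of L′ because of two parities at the
-- boundary of the disc, both found by summing over all ends of the diagram a function of the
-- side of the disc they lie on (arcs only leave R through the boundary): two of the four
-- boundary strands point into R, and an even number of boundary points are coloured true.
-- A crossing in R keeps its sign while its two strands exchange (possibly complemented)
-- colours, so the cut is unchanged.

module Submission where

open import Defs
open import Algebra.Bundles using (AbelianGroup; CommutativeMonoid; CommutativeRing)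
import Algebra.Properties.CommutativeMonoid.Sum as MonoidSum
import Algebra.Properties.Group as GroupProperties
open import Data.Bool using (Bool; true; false; not; _∧_; _∨_; _xor_; if_then_else_)
import Data.Bool as Bool
open import Data.Bool.Properties
  using ( xor-∧-commutativeRing; xor-same; xor-comm; xor-assoc; xor-identityʳ; xor-inverseʳ
        ; xor-annihilates-not; true-xor; not-injective; not-involutive
        ; ∧-comm; ∧-conicalˡ; ∧-conicalʳ; ∧-inverseʳ; ∧-distribʳ-xor; if-∧ )
open import Data.Empty using (⊥-elim)
open import Data.Fin using (Fin; zero; suc; _↑ˡ_; _↑ʳ_)
open import Data.Fin.Patterns using (0F; 1F; 2F; 3F)
open import Data.Fin.Properties using (_≟_; ¬Fin0; +↔⊎; splitAt-↑ˡ; splitAt-↑ʳ)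
open import Data.Integer using (ℤ; +_; -_; _+_; _*_)
import Data.Integer.Properties as ℤP
open import Data.Nat using (ℕ; zero; suc) renaming (_+_ to _+ℕ_)
open import Data.Product using (∃; _,_)
open import Data.Sum using (_⊎_; inj₁; inj₂)
import Data.Sum as Sum
open import Data.Sum.Function.Propositional using (_⊎-↔_)
open import Data.Vec using (Vec; []; _∷_; tabulate; map)
open import Function using (_∘_)
open import Function.Bundles using (_↔_; mk↔ₛ′; Inverse)
open import Function.Construct.Composition using (_↔-∘_)
open import Function.Construct.Identity using (↔-id)
open import Function.Construct.Symmetry using (↔-sym)
open import Relation.Binary.PropositionalEquality
  using (_≡_; _≗_; refl; cong; cong₂; sym; trans; module ≡-Reasoning)
open import Relation.Nullary using (yes; no)
open import Relation.Nullary.Decidable using (⌊_⌋)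

if-true : ∀ {A : Set} {b} {x y : A} → b ≡ true → (if b then x else y) ≡ x
if-true refl = refl

if-false : ∀ {A : Set} {b} {x y : A} → b ≡ false → (if b then x else y) ≡ y
if-false refl = refl

xor-cancelˡ : ∀ x y → x xor (x xor y) ≡ y
xor-cancelˡ true  y = not-involutive y
xor-cancelˡ false y = refl

xor-cancelʳ : ∀ x y → (x xor y) xor y ≡ x
xor-cancelʳ x y = trans (xor-assoc x y y) (trans (cong (x xor_) (xor-same y)) (xor-identityʳ x))

xor-translate : ∀ a b t → (a xor t) xor (b xor t) ≡ a xor b
xor-translate a b t = begin
  (a xor t) xor (b xor t) ≡⟨ cong ((a xor t) xor_) (xor-comm b t) ⟩
  (a xor t) xor (t xor b) ≡⟨ xor-assoc a t (t xor b) ⟩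
  a xor (t xor (t xor b)) ≡⟨ cong (a xor_) (xor-cancelˡ t b) ⟩
  a xor b                 ∎
  where open ≡-Reasoning

≟-xor : ∀ a b → ⌊ a Bool.≟ b ⌋ ≡ not (a xor b)
≟-xor true  true  = refl
≟-xor true  false = refl
≟-xor false true  = refl
≟-xor false false = refl

record Enumeration (A : Set) : Set where
  field
    size  : ℕ
    index : A ↔ Fin size

open Enumeration

finᵉ : ∀ k → Enumeration (Fin k)
finᵉ k = record { index = ↔-id _ }

_⊎ᵉ_ : ∀ {A B} → Enumeration A → Enumeration B → Enumeration (A ⊎ B)
eA ⊎ᵉ eB = record { index = ↔-sym +↔⊎ ↔-∘ (index eA ⊎-↔ index eB) }

via : ∀ {A B} → A ↔ B → Enumeration B → Enumeration A
via φ e = record { index = index e ↔-∘ φ }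

module FiniteSum {c ℓ} (M : CommutativeMonoid c ℓ) where
  open CommutativeMonoid M
    using (Carrier; _≈_; _∙_; setoid; assoc; identityˡ; ∙-cong; ∙-congˡ; reflexive)
    renaming (sym to ≈-sym; trans to ≈-trans)
  open MonoidSum M using (sum-syntax; sum-cong-≗; sum-permute)
  open import Relation.Binary.Reasoning.Setoid setoid

  Σ⟨_⟩ : ∀ {A} → Enumeration A → (A → Carrier) → Carrier
  Σ⟨ e ⟩ h = ∑[ k < size e ] h (Inverse.from (index e) k)

  Σ-cong : ∀ {A} (e : Enumeration A) {h h′ : A → Carrier} →
           h ≗ h′ → Σ⟨ e ⟩ h ≡ Σ⟨ e ⟩ h′
  Σ-cong e h≗h′ = sum-cong-≗ (λ k → h≗h′ (Inverse.from (index e) k))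

  ∑-↑ : ∀ m {n} (f : Fin (m +ℕ n) → Carrier) →
        ∑[ k < m +ℕ n ] f k ≈ ∑[ i < m ] f (i ↑ˡ n) ∙ ∑[ j < n ] f (m ↑ʳ j)
  ∑-↑ zero    f = ≈-sym (identityˡ _)
  ∑-↑ (suc m) f = ≈-trans (∙-congˡ (∑-↑ m (f ∘ suc))) (≈-sym (assoc _ _ _))

  Σ-⊎ : ∀ {A B} (eA : Enumeration A) (eB : Enumeration B) (h : A ⊎ B → Carrier) →
        Σ⟨ eA ⊎ᵉ eB ⟩ h ≈ Σ⟨ eA ⟩ (h ∘ inj₁) ∙ Σ⟨ eB ⟩ (h ∘ inj₂)
  Σ-⊎ eA eB h = ≈-trans (∑-↑ (size eA) _) (∙-cong
    (reflexive (sum-cong-≗ λ i → cong (h ∘ Sum.map _ _) (splitAt-↑ˡ (size eA) i (size eB))))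
    (reflexive (sum-cong-≗ λ j → cong (h ∘ Sum.map _ _) (splitAt-↑ʳ (size eA) (size eB) j))))

  Σ-permute : ∀ {A} (e : Enumeration A) (π : A ↔ A) (h : A → Carrier) →
              Σ⟨ e ⟩ (h ∘ Inverse.to π) ≈ Σ⟨ e ⟩ h
  Σ-permute e π h = ≈-sym (begin
    Σ⟨ e ⟩ h                                      ≈⟨ sum-permute (h ∘ from (index e)) ρ ⟩
    ∑[ k < size e ] h (from (index e) (to (index e) (to π (from (index e) k))))
      ≡⟨ sum-cong-≗ (λ k → cong h (strictlyInverseʳ (index e) (to π (from (index e) k)))) ⟩
    Σ⟨ e ⟩ (h ∘ to π)                              ∎)
    where
    open Inverse
    ρ : Fin (size e) ↔ Fin (size e)
    ρ = index e ↔-∘ (π ↔-∘ ↔-sym (index e))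

-- Ends of a diagram and the flow through the disc boundary

end-shape : ∀ {n} → Out n ↔ (Fin 4 ⊎ (Fin n ⊎ Fin n))
end-shape = mk↔ₛ′ to from to∘from from∘to
  where
  to : ∀ {n} → Out n → Fin 4 ⊎ (Fin n ⊎ Fin n)
  to (bOut i)       = inj₁ i
  to (cOut x over)  = inj₂ (inj₁ x)
  to (cOut x under) = inj₂ (inj₂ x)
  from : ∀ {n} → Fin 4 ⊎ (Fin n ⊎ Fin n) → Out n
  from (inj₁ i)        = bOut i
  from (inj₂ (inj₁ x)) = cOut x over
  from (inj₂ (inj₂ x)) = cOut x under
  to∘from : ∀ {n} (y : Fin 4 ⊎ (Fin n ⊎ Fin n)) → to (from y) ≡ y
  to∘from (inj₁ i)        = refl
  to∘from (inj₂ (inj₁ x)) = refl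
  to∘from (inj₂ (inj₂ x)) = refl
  from∘to : ∀ {n} (o : Out n) → from (to o) ≡ o
  from∘to (bOut i)       = refl
  from∘to (cOut x over)  = refl
  from∘to (cOut x under) = refl

ends : ∀ n → Enumeration (Out n)
ends n = via end-shape (finᵉ 4 ⊎ᵉ (finᵉ n ⊎ᵉ finᵉ n))

incoming : ∀ {n} → Out n → In n
incoming (cOut x s) = cIn x s
incoming (bOut i)   = bIn i

cont-incoming : ∀ {n} (o : Out n) → cont (incoming o) ≡ o
cont-incoming (cOut x s) = refl
cont-incoming (bOut i)   = refl

incoming-cont : ∀ {n} (i : In n) → incoming (cont i) ≡ i
incoming-cont (cIn x s) = refl
incoming-cont (bIn i)   = refl

successor : ∀ {n ℓ} → Diagram n ℓ → Out n ↔ Out n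
successor D = mk↔ₛ′ (succA D) (prev D ∘ incoming)
  (λ o → trans (cong cont (next-prev D (incoming o))) (cont-incoming o))
  (λ o → trans (cong (prev D) (incoming-cont (next D o))) (prev-next D o))

side : ∀ {n ℓ} → Diagram n ℓ → Out n → Bool
side D = sideOut (inR D) (inward D)

sideᴵ : ∀ {n ℓ} → Diagram n ℓ → In n → Bool
sideᴵ D = sideIn (inR D) (inward D)

entry-side-succ : ∀ {n ℓ} (D : Diagram n ℓ) o →
  sideᴵ D (incoming (succA D o)) ≡ side D o
entry-side-succ D o = trans (cong (sideᴵ D) (incoming-cont (next D o))) (sides D o)

ArcInvariant : ∀ {n ℓ} {A : Set} → Diagram n ℓ → (Out n → A) → Set
ArcInvariant D c = ∀ o → c (succA D o) ≡ c o

module _ {a r} (G : AbelianGroup a r) where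
  open AbelianGroup G using (Carrier; _≈_; _∙_; setoid; ∙-congˡ; commutativeMonoid)
    renaming (sym to ≈-sym; trans to ≈-trans)
  open GroupProperties (AbelianGroup.group G) using (∙-cancelʳ)
  open FiniteSum commutativeMonoid
  open MonoidSum commutativeMonoid using (sum)
  open import Relation.Binary.Reasoning.Setoid setoid

  -- The arc leaving an end arrives on the same side of the disc with the same colour, and succA
  -- permutes the ends; crossing ends count alike as exits and as entries, so only the boundary differs.
  boundary-balance : ∀ {n ℓ} (D : Diagram n ℓ) (c : Out n → Bool) → ArcInvariant D c →
    (φ : Bool → Bool → Carrier) →
    sum (λ i → φ (inward D i) (c (bOut i))) ≈ sum (λ i → φ (not (inward D i)) (c (bOut i)))
  boundary-balance {n} D c invariant φ = ∙-cancelʳ crossings _ _ (begin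
    sum (exit ∘ bOut) ∙ crossings  ≈⟨ ≈-sym (Σ-ends exit) ⟩
    Σ⟨ ends n ⟩ exit               ≡⟨ Σ-cong (ends n) exit-entry ⟩
    Σ⟨ ends n ⟩ (entry ∘ succA D)  ≈⟨ Σ-permute (ends n) (successor D) entry ⟩
    Σ⟨ ends n ⟩ entry              ≈⟨ Σ-ends entry ⟩
    sum (entry ∘ bOut) ∙ crossings ∎)
    where
    exit entry : Out n → Carrier
    exit o  = φ (side D o) (c o)
    entry o = φ (sideᴵ D (incoming o)) (c o)
    crossings : Carrier
    crossings = sum (λ x → exit (cOut x over)) ∙ sum (λ x → exit (cOut x under))
    Σ-ends : (h : Out n → Carrier) →
      Σ⟨ ends n ⟩ h ≈
      sum (h ∘ bOut) ∙ (sum (λ x → h (cOut x over)) ∙ sum (λ x → h (cOut x under)))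
    Σ-ends h = ≈-trans (Σ-⊎ (finᵉ 4) (finᵉ n ⊎ᵉ finᵉ n) (h ∘ Inverse.from end-shape))
      (∙-congˡ (Σ-⊎ (finᵉ n) (finᵉ n) (h ∘ Inverse.from end-shape ∘ inj₂)))
    exit-entry : ∀ o → exit o ≡ entry (succA D o)
    exit-entry o = cong₂ φ (sym (entry-side-succ D o)) (sym (invariant o))

-- Parities at the boundary of the disc

indicator : Bool → ℤ
indicator b = if b then + 1 else + 0

balanced-pairs : ∀ a b c d →
  indicator a + (indicator b + (indicator c + (indicator d + + 0))) ≡
  indicator (not a) + (indicator (not b) + (indicator (not c) + (indicator (not d) + + 0))) →
  a xor b ≡ c xor d
balanced-pairs true  true  true  true  ()
balanced-pairs true  true  true  false ()
balanced-pairs true  true  false true  ()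
balanced-pairs true  true  false false _ = refl
balanced-pairs true  false true  true  ()
balanced-pairs true  false true  false _ = refl
balanced-pairs true  false false true  _ = refl
balanced-pairs true  false false false ()
balanced-pairs false true  true  true  ()
balanced-pairs false true  true  false _ = refl
balanced-pairs false true  false true  _ = refl
balanced-pairs false true  false false ()
balanced-pairs false false true  true  _ = refl
balanced-pairs false false true  false ()
balanced-pairs false false false true  ()
balanced-pairs false false false false ()

even-pairs : ∀ a b c d → a xor (b xor (c xor (d xor false))) ≡ false → a xor b ≡ c xor d
even-pairs true  true  true  true  _ = refl
even-pairs true  true  true  false ()
even-pairs true  true  false true  ()
even-pairs true  true  false false _ = refl
even-pairs true  false true  true  ()
even-pairs true  false true  false _ = refl
even-pairs true  false false true  _ = refl
even-pairs true  false false false ()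
even-pairs false true  true  true  ()
even-pairs false true  true  false _ = refl
even-pairs false true  false true  _ = refl
even-pairs false true  false false ()
even-pairs false false true  true  _ = refl
even-pairs false false true  false ()
even-pairs false false false true  ()
even-pairs false false false false _ = refl

orientation-parity : ∀ {n ℓ} (D : Diagram n ℓ) →
  inward D 0F xor inward D 1F ≡ inward D 2F xor inward D 3F
orientation-parity D = balanced-pairs (inward D 0F) (inward D 1F) (inward D 2F) (inward D 3F)
  (boundary-balance ℤP.+-0-abelianGroup D (λ _ → true) (λ _ → refl) (λ s _ → indicator s))

colour-parity : ∀ {n ℓ} (D : Diagram n ℓ) (c : Out n → Bool) → ArcInvariant D c →
  c (bOut 0F) xor c (bOut 1F) ≡ c (bOut 2F) xor c (bOut 3F)
colour-parity D c invariant = even-pairs (c (bOut 0F)) (c (bOut 1F)) (c (bOut 2F)) (c (bOut 3F)) (begin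
  sum (c ∘ bOut)                                     ≡⟨ sum-cong-≗ split ⟩
  sum (λ i → (w i ∧ c (bOut i)) xor (not (w i) ∧ c (bOut i)))
    ≡⟨ ∑-distrib-+ (λ i → w i ∧ c (bOut i)) (λ i → not (w i) ∧ c (bOut i)) ⟩
  inside xor outside                                 ≡⟨ cong (_xor outside) balance ⟩
  outside xor outside                                ≡⟨ xor-same outside ⟩
  false                                              ∎)
  where
  open ≡-Reasoning
  xorGroup : AbelianGroup _ _
  xorGroup = CommutativeRing.+-abelianGroup xor-∧-commutativeRing
  open MonoidSum (AbelianGroup.commutativeMonoid xorGroup) using (sum; sum-cong-≗; ∑-distrib-+)
  w : Fin 4 → Bool
  w = inward D
  inside outside : Bool
  inside  = sum (λ i → w i ∧ c (bOut i))
  outside = sum (λ i → not (w i) ∧ c (bOut i))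
  balance : inside ≡ outside
  balance = boundary-balance xorGroup D c invariant _∧_
  split : ∀ i → c (bOut i) ≡ (w i ∧ c (bOut i)) xor (not (w i) ∧ c (bOut i))
  split i = trans (cong (_∧ c (bOut i)) (sym (xor-inverseʳ (w i))))
                  (∧-distribʳ-xor (c (bOut i)) (w i) (not (w i)))

σ-shift : (b : Fin 4 → Bool) → b 0F xor b 1F ≡ b 2F xor b 3F →
  ∀ i → b (σ i) ≡ b i xor (b 0F xor b 1F)
σ-shift b parity 0F = sym (xor-cancelˡ (b 0F) (b 1F))
σ-shift b parity 1F = sym (trans (cong (b 1F xor_) (xor-comm (b 0F) (b 1F))) (xor-cancelˡ (b 1F) (b 0F)))
σ-shift b parity 2F = sym (trans (cong (b 2F xor_) parity) (xor-cancelˡ (b 2F) (b 3F)))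
σ-shift b parity 3F =
  sym (trans (cong (b 3F xor_) (trans parity (xor-comm (b 2F) (b 3F)))) (xor-cancelˡ (b 3F) (b 2F)))

module _ {n ℓ} (D : Diagram n ℓ) where

  inward-σ : ∀ i → inward D (σ i) ≡ inward D i xor (inward D 0F xor inward D 1F)
  inward-σ = σ-shift (inward D) (orientation-parity D)

  keepOr-xor : keepOr D ≡ not (inward D 0F xor inward D 1F)
  keepOr-xor = ≟-xor (inward D 0F) (inward D 1F)

  side-ρOut : keepOr D ≡ true → ∀ o → side D (ρOut o) ≡ side D o
  side-ρOut keep (cOut x s) = refl
  side-ρOut keep (bOut i)   = begin
    inward D (σ i)                                 ≡⟨ inward-σ i ⟩
    inward D i xor (inward D 0F xor inward D 1F)   ≡⟨ cong (inward D i xor_) kept ⟩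
    inward D i xor false                           ≡⟨ xor-identityʳ (inward D i) ⟩
    inward D i                                     ∎
    where
    open ≡-Reasoning
    kept : inward D 0F xor inward D 1F ≡ false
    kept = not-injective (trans (sym keepOr-xor) keep)

  side-flipOI : keepOr D ≡ false → ∀ o → sideᴵ D (flipOI o) ≡ side D o
  side-flipOI flip (cOut x s) = refl
  side-flipOI flip (bOut i)   = begin
    not (inward D (σ i))                                 ≡⟨ cong not (inward-σ i) ⟩
    not (inward D i xor (inward D 0F xor inward D 1F))
      ≡⟨ cong (λ r → not (inward D i xor r)) reversed ⟩
    not (inward D i xor true)
      ≡⟨ cong not (trans (xor-comm (inward D i) true) (true-xor (inward D i))) ⟩
    not (not (inward D i))                               ≡⟨ not-involutive (inward D i) ⟩
    inward D i                                           ∎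
    where
    open ≡-Reasoning
    reversed : inward D 0F xor inward D 1F ≡ true
    reversed = not-injective (trans (sym keepOr-xor) flip)

swapS-involutive : ∀ s → swapS (swapS s) ≡ s
swapS-involutive over  = refl
swapS-involutive under = refl

cont-ρIn : ∀ {n} (i : In n) → cont (ρIn i) ≡ ρOut (cont i)
cont-ρIn (cIn x s) = refl
cont-ρIn (bIn i)   = refl

cont-flipOI : ∀ {n} (o : Out n) → cont (flipOI o) ≡ ρOut o
cont-flipOI (cOut x s) = refl
cont-flipOI (bOut i)   = refl

σ-involutive : ∀ i → σ (σ i) ≡ i
σ-involutive 0F = refl
σ-involutive 1F = refl
σ-involutive 2F = refl
σ-involutive 3F = refl

ρOut-involutive : ∀ {n} (o : Out n) → ρOut (ρOut o) ≡ o
ρOut-involutive (cOut x s) = cong (cOut x) (swapS-involutive s)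
ρOut-involutive (bOut i)   = cong bOut (σ-involutive i)

ρIn-involutive : ∀ {n} (i : In n) → ρIn (ρIn i) ≡ i
ρIn-involutive (cIn x s) = cong (cIn x) (swapS-involutive s)
ρIn-involutive (bIn i)   = cong bIn (σ-involutive i)

flipOI-injective : ∀ {n} {o o′ : Out n} → flipOI o ≡ flipOI o′ → o ≡ o′
flipOI-injective {o = o} {o′} eq = begin
  o                     ≡⟨ sym (ρOut-involutive o) ⟩
  ρOut (ρOut o)         ≡⟨ cong ρOut (sym (cont-flipOI o)) ⟩
  ρOut (cont (flipOI o))  ≡⟨ cong (ρOut ∘ cont) eq ⟩
  ρOut (cont (flipOI o′)) ≡⟨ cong ρOut (cont-flipOI o′) ⟩
  ρOut (ρOut o′)        ≡⟨ ρOut-involutive o′ ⟩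
  o′                    ∎
  where open ≡-Reasoning

-- Colourings of the mutant

open MonoidSum ℤP.+-0-commutativeMonoid
  using (sum; sum-syntax; sum-cong-≗; ∑-comm; ∑-distrib-+; sum-replicate-zero)

crossingCut : ∀ {n ℓ} → Diagram n ℓ → (Out n → Bool) → ℤ
crossingCut {n} D c = ∑[ x < n ] (if c (cOut x over) xor c (cOut x under) then sign D x else + 0)

twist : ∀ {n} → (Out n → Bool) → Bool
twist c = c (bOut 0F) xor c (bOut 1F)

mutateColouring : ∀ {n ℓ} → Diagram n ℓ → (Out n → Bool) → Out n → Bool
mutateColouring D c o = if side D o then c (ρOut o) xor twist c else c o

module _ {n ℓ} (D : Diagram n ℓ) (c : Out n → Bool) (invariant : ArcInvariant D c) where

  colour-prev : ∀ i → c (prev D i) ≡ c (cont i)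
  colour-prev i = trans (sym (invariant (prev D i))) (cong (c ∘ cont) (next-prev D i))

  twist-σ : ∀ i → c (bOut (σ i)) ≡ c (bOut i) xor twist c
  twist-σ = σ-shift (c ∘ bOut) (colour-parity D c invariant)

  mutateColouring-boundary : ∀ j → mutateColouring D c (bOut j) ≡ c (bOut j)
  mutateColouring-boundary j with inward D j
  ... | true  = trans (cong (_xor twist c) (twist-σ j)) (xor-cancelʳ (c (bOut j)) (twist c))
  ... | false = refl

  mutateColouring-ρ-boundary : ∀ j → mutateColouring D c (ρOut (bOut j)) ≡ c (bOut j) xor twist c
  mutateColouring-ρ-boundary j = trans (mutateColouring-boundary (σ j)) (twist-σ j)

  mutateColouring-ρ-inside : ∀ q → side D q ≡ true →
    mutateColouring D c (ρOut q) ≡ c q xor twist c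
  mutateColouring-ρ-inside (cOut x s) p =
    trans (if-true p) (cong (λ s′ → c (cOut x s′) xor twist c) (swapS-involutive s))
  mutateColouring-ρ-inside (bOut j) _ = mutateColouring-ρ-boundary j

  mutateColouring-ρ-entering : ∀ i → sideᴵ D i ≡ true →
    mutateColouring D c (ρOut (cont i)) ≡ c (cont i) xor twist c
  mutateColouring-ρ-entering (cIn x s) p = mutateColouring-ρ-inside (cOut x s) p
  mutateColouring-ρ-entering (bIn j)   _ = mutateColouring-ρ-boundary j

  mutateColouring-entering-outside : ∀ i → sideᴵ D i ≡ false →
    mutateColouring D c (cont i) ≡ c (cont i)
  mutateColouring-entering-outside (cIn x s) p = if-false p
  mutateColouring-entering-outside (bIn j)   _ = mutateColouring-boundary j

module _ {n ℓ} {L L′ : Diagram n ℓ} (mutant : IsMutant L L′) where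
  open IsMutant mutant
  open ≡-Reasoning

  side-mutant : ∀ o → side L′ o ≡ side L o
  side-mutant (cOut x s) = same-inR x
  side-mutant (bOut i)   = same-inward i

  mutateColouring-invariant : ∀ {c} → ArcInvariant L c → ArcInvariant L′ (mutateColouring L c)
  mutateColouring-invariant {c} invariant o = trans (cong (mc ∘ cont) (arcs o)) (along o)
    where
    mc : Out n → Bool
    mc = mutateColouring L c
    t : Bool
    t = twist c
    along : ∀ o → mc (cont (mutNext L o)) ≡ mc o
    along o with side L o in p | keepOr L in k
    ... | false | _ = begin
      mc (succA L o)
        ≡⟨ mutateColouring-entering-outside L c invariant (next L o) (trans (sides L o) p) ⟩
      c (succA L o)           ≡⟨ invariant o ⟩
      c o                     ∎
    ... | true | true = begin
      mc (cont (ρIn (next L (ρOut o)))) ≡⟨ cong mc (cont-ρIn (next L (ρOut o))) ⟩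
      mc (ρOut (succA L (ρOut o)))      ≡⟨ mutateColouring-ρ-entering L c invariant (next L (ρOut o))
                                             (trans (sides L (ρOut o)) (trans (side-ρOut L k o) p)) ⟩
      c (succA L (ρOut o)) xor t        ≡⟨ cong (_xor t) (invariant (ρOut o)) ⟩
      c (ρOut o) xor t                  ∎
    ... | true | false = begin
      mc (cont (flipOI q))     ≡⟨ cong mc (cont-flipOI q) ⟩
      mc (ρOut q)              ≡⟨ mutateColouring-ρ-inside L c invariant q q-inside ⟩
      c q xor t
        ≡⟨ cong (_xor t) (trans (colour-prev L c invariant (flipOI o)) (cong c (cont-flipOI o))) ⟩
      c (ρOut o) xor t         ∎
      where
      q : Out n
      q = prev L (flipOI o)
      q-inside : side L q ≡ true
      q-inside = trans (sym (sides L q))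
        (trans (cong (sideᴵ L) (next-prev L (flipOI o))) (trans (side-flipOI L k o) p))

  crossingCut-mutate : ∀ c → crossingCut L′ (mutateColouring L c) ≡ crossingCut L c
  crossingCut-mutate c = sum-cong-≗ λ x →
    cong₂ (λ b s → if b then s else + 0)
          (bichromatic x) (cong (λ b → if b then + 1 else - (+ 1)) (same-ccw x))
    where
    bichromatic : ∀ x → mutateColouring L c (cOut x over) xor mutateColouring L c (cOut x under)
                        ≡ c (cOut x over) xor c (cOut x under)
    bichromatic x with inR L x
    ... | true  = trans (xor-translate (c (cOut x under)) (c (cOut x over)) (twist c))
                        (xor-comm (c (cOut x under)) (c (cOut x over)))
    ... | false = refl

  mutateColouring-involutive : ∀ {c} → ArcInvariant L c →
    ∀ {c′} → c′ ≗ mutateColouring L c → mutateColouring L′ c′ ≗ c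
  mutateColouring-involutive {c} invariant {c′} c′≗ o with side L′ o in p
  ... | true  = begin
    c′ (ρOut o) xor twist c′                 ≡⟨ cong₂ _xor_ (c′≗ (ρOut o)) same-twist ⟩
    mutateColouring L c (ρOut o) xor twist c ≡⟨ cong (_xor twist c) (mutateColouring-ρ-inside L c invariant o
                                                  (trans (sym (side-mutant o)) p)) ⟩
    (c o xor twist c) xor twist c            ≡⟨ xor-cancelʳ (c o) (twist c) ⟩
    c o                                      ∎
    where
    same-twist : twist c′ ≡ twist c
    same-twist = cong₂ _xor_ (trans (c′≗ (bOut 0F)) (mutateColouring-boundary L c invariant 0F))
                             (trans (c′≗ (bOut 1F)) (mutateColouring-boundary L c invariant 1F))
  ... | false = trans (c′≗ o) (if-false (trans (sym (side-mutant o)) p))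

  mutant-sym : IsMutant L′ L
  mutant-sym = record
    { same-ccw    = sym ∘ same-ccw
    ; same-inR    = sym ∘ same-inR
    ; same-inward = sym ∘ same-inward
    ; arcs        = sym ∘ unmutate
    }
    where
    same-keepOr : keepOr L′ ≡ keepOr L
    same-keepOr = cong₂ (λ a b → ⌊ a Bool.≟ b ⌋) (same-inward 0F) (same-inward 1F)
    sideIn-mutant : ∀ i → sideᴵ L′ i ≡ sideᴵ L i
    sideIn-mutant (cIn x s) = same-inR x
    sideIn-mutant (bIn i)   = cong not (same-inward i)
    unmutate : ∀ o → mutNext L′ o ≡ next L o
    unmutate o rewrite side-mutant o | same-keepOr with side L o in p | keepOr L in k
    ... | false | _    = trans (arcs o) (if-false p)
    ... | true  | true = begin
      ρIn (next L′ (ρOut o))             ≡⟨ cong ρIn (arcs (ρOut o)) ⟩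
      ρIn (mutNext L (ρOut o))
        ≡⟨ cong ρIn (trans (if-true (trans (side-ρOut L k o) p)) (if-true k)) ⟩
      ρIn (ρIn (next L (ρOut (ρOut o)))) ≡⟨ ρIn-involutive _ ⟩
      next L (ρOut (ρOut o))             ≡⟨ cong (next L) (ρOut-involutive o) ⟩
      next L o                           ∎
    ... | true  | false = begin
      flipOI q                            ≡⟨ sym (next-prev L (flipOI q)) ⟩
      next L (prev L (flipOI q))          ≡⟨ cong (next L) (flipOI-injective back) ⟩
      next L o                            ∎
      where
      q : Out n
      q = prev L′ (flipOI o)
      q-inside : side L q ≡ true
      q-inside = begin
        side L q            ≡⟨ sym (side-mutant q) ⟩
        side L′ q          ≡⟨ sym (sides L′ q) ⟩
        sideᴵ L′ (next L′ q) ≡⟨ cong (sideᴵ L′) (next-prev L′ (flipOI o)) ⟩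
        sideᴵ L′ (flipOI o)  ≡⟨ sideIn-mutant (flipOI o) ⟩
        sideᴵ L (flipOI o)    ≡⟨ side-flipOI L k o ⟩
        side L o            ≡⟨ p ⟩
        true                                    ∎
      back : flipOI (prev L (flipOI q)) ≡ flipOI o
      back = begin
        flipOI (prev L (flipOI q)) ≡⟨ sym (trans (if-true q-inside) (if-false k)) ⟩
        mutNext L q                ≡⟨ sym (arcs q) ⟩
        next L′ q                  ≡⟨ next-prev L′ (flipOI o) ⟩
        flipOI o                   ∎

-- The cut as a sum over crossings

sumℤ≡∑ : ∀ {m} (g : Fin m → ℤ) → sumℤ g ≡ sum g
sumℤ≡∑ {zero}  g = refl
sumℤ≡∑ {suc m} g = cong (λ v → g zero + v) (sumℤ≡∑ (g ∘ suc))

∑-if : ∀ {m} b (g : Fin m → ℤ) → (if b then sum g else + 0) ≡ ∑[ x < m ] (if b then g x else + 0)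
∑-if {m} true  g = refl
∑-if {m} false g = sym (sum-replicate-zero m)

eqF-suc : ∀ {N} (a j : Fin N) → eqF {suc N} (suc a) (suc j) ≡ eqF a j
eqF-suc a j with a ≟ j
... | yes _ = refl
... | no _  = refl

eqF⇒≡ : ∀ {N} {a j : Fin N} → eqF a j ≡ true → a ≡ j
eqF⇒≡ {a = a} {j} e with a ≟ j
... | yes a≡j = a≡j
eqF⇒≡ () | no _

∑-delta : ∀ {N} (a : Fin N) (g : Fin N → ℤ) → ∑[ j < N ] (if eqF a j then g j else + 0) ≡ g a
∑-delta {suc N} zero g = trans (cong (λ v → g zero + v) (sum-replicate-zero N)) (ℤP.+-identityʳ (g zero))
∑-delta {suc N} (suc a) g = trans (ℤP.+-identityˡ _) (trans
  (sum-cong-≗ (λ j → cong (λ b → if b then g (suc j) else + 0) (eqF-suc a j))) (∑-delta a (g ∘ suc)))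

∑∑-delta : ∀ {N} (a b : Fin N) (G : Fin N → Fin N → ℤ) →
  ∑[ j < N ] ∑[ k < N ] (if eqF a j ∧ eqF b k then G j k else + 0) ≡ G a b
∑∑-delta {N} a b G = begin
  ∑[ j < N ] ∑[ k < N ] (if eqF a j ∧ eqF b k then G j k else + 0)
    ≡⟨ sum-cong-≗ (λ j → trans (sum-cong-≗ (λ k → if-∧ (eqF a j) {eqF b k}))
                               (sym (∑-if (eqF a j) (λ k → if eqF b k then G j k else + 0)))) ⟩
  ∑[ j < N ] (if eqF a j then ∑[ k < N ] (if eqF b k then G j k else + 0) else + 0)
    ≡⟨ sum-cong-≗ (λ j → cong (λ v → if eqF a j then v else + 0) (∑-delta b (G j))) ⟩
  ∑[ j < N ] (if eqF a j then G j b else + 0)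
    ≡⟨ ∑-delta a (λ j → G j b) ⟩
  G a b ∎
  where open ≡-Reasoning

if-∨-disjoint : ∀ P X Y (s : ℤ) → (X ∧ Y ≡ true → P ≡ false) →
  (if P then (if X ∨ Y then s else + 0) else + 0) ≡
  (if X then (if P then s else + 0) else + 0) + (if Y then (if P then s else + 0) else + 0)
if-∨-disjoint true  true  true  s disjoint with disjoint refl
... | ()
if-∨-disjoint true  true  false s _ = sym (ℤP.+-identityʳ s)
if-∨-disjoint true  false true  s _ = sym (ℤP.+-identityˡ s)
if-∨-disjoint true  false false s _ = refl
if-∨-disjoint false true  true  s _ = refl
if-∨-disjoint false true  false s _ = refl
if-∨-disjoint false false true  s _ = refl
if-∨-disjoint false false false s _ = refl

if-xor-split : ∀ p q (s : ℤ) →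
  (if p ∧ not q then s else + 0) + (if q ∧ not p then s else + 0) ≡ (if p xor q then s else + 0)
if-xor-split true  true  s = refl
if-xor-split true  false s = ℤP.+-identityʳ s
if-xor-split false true  s = ℤP.+-identityˡ s
if-xor-split false false s = refl

crossing-contribution : ∀ {N} (m : Fin N → Bool) (a b : Fin N) (s : ℤ) →
  ∑[ j < N ] ∑[ k < N ] (if m j ∧ not (m k)
                         then (if (eqF a j ∧ eqF b k) ∨ (eqF a k ∧ eqF b j) then s else + 0) else + 0)
  ≡ (if m a xor m b then s else + 0)
crossing-contribution {N} m a b s = begin
  ∑[ j < N ] ∑[ k < N ] (if m j ∧ not (m k)
                         then (if (eqF a j ∧ eqF b k) ∨ (eqF a k ∧ eqF b j) then s else + 0) else + 0)
    ≡⟨ sum-cong-≗ (λ j → trans (sum-cong-≗ (split j)) (∑-distrib-+ (A j) (B j))) ⟩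
  ∑[ j < N ] (∑[ k < N ] (if eqF a j ∧ eqF b k then G j k else + 0)
              + ∑[ k < N ] (if eqF b j ∧ eqF a k then G j k else + 0))
    ≡⟨ ∑-distrib-+ (λ j → sum (A j)) (λ j → sum (B j)) ⟩
  ∑[ j < N ] ∑[ k < N ] (if eqF a j ∧ eqF b k then G j k else + 0)
    + ∑[ j < N ] ∑[ k < N ] (if eqF b j ∧ eqF a k then G j k else + 0)
    ≡⟨ cong₂ _+_ (∑∑-delta a b G) (∑∑-delta b a G) ⟩
  G a b + G b a
    ≡⟨ if-xor-split (m a) (m b) s ⟩
  (if m a xor m b then s else + 0) ∎
  where
  open ≡-Reasoning
  G : _ → _ → ℤ
  G j k = if m j ∧ not (m k) then s else + 0
  A B : Fin N → Fin N → ℤ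
  A j k = if eqF a j ∧ eqF b k then G j k else + 0
  B j k = if eqF b j ∧ eqF a k then G j k else + 0
  split : ∀ j k → (if m j ∧ not (m k)
                   then (if (eqF a j ∧ eqF b k) ∨ (eqF a k ∧ eqF b j) then s else + 0) else + 0)
                ≡ (if eqF a j ∧ eqF b k then G j k else + 0) + (if eqF b j ∧ eqF a k then G j k else + 0)
  split j k = trans (if-∨-disjoint (m j ∧ not (m k)) (eqF a j ∧ eqF b k) (eqF a k ∧ eqF b j) s diagonal)
    (cong (λ Y → (if eqF a j ∧ eqF b k then G j k else + 0) + (if Y then G j k else + 0))
          (∧-comm (eqF a k) (eqF b j)))
    where
    diagonal : (eqF a j ∧ eqF b k) ∧ (eqF a k ∧ eqF b j) ≡ true → m j ∧ not (m k) ≡ false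
    diagonal both = trans (cong (λ i → m j ∧ not (m i)) (sym j≡k)) (∧-inverseʳ (m j))
      where
      j≡k : j ≡ k
      j≡k = trans (sym (eqF⇒≡ (∧-conicalˡ (eqF a j) (eqF b k) (∧-conicalˡ _ (eqF a k ∧ eqF b j) both))))
                  (eqF⇒≡ (∧-conicalˡ (eqF a k) (eqF b j) (∧-conicalʳ (eqF a j ∧ eqF b k) _ both)))

colourOf : ∀ {n ℓ N} {D : Diagram n ℓ} → Labelling D N → Vec Bool N → Out n → Bool
colourOf λ′ E o = member E (lab λ′ o)

cut-crossingCut : ∀ {n ℓ N} (D : Diagram n ℓ) (λ′ : Labelling D N) (E : Vec Bool N) →
  cut D λ′ E ≡ crossingCut D (colourOf λ′ E)
cut-crossingCut {n} {N = N} D λ′ E = begin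
  cut D λ′ E
    ≡⟨ trans (sumℤ≡∑ (λ j → sumℤ (entry j)))
             (sum-cong-≗ λ j → trans (sumℤ≡∑ (entry j)) (sum-cong-≗ (weighted j))) ⟩
  ∑[ j < N ] ∑[ k < N ] ∑[ x < n ] term j k x
    ≡⟨ sum-cong-≗ (λ j → ∑-comm (term j)) ⟩
  ∑[ j < N ] ∑[ x < n ] ∑[ k < N ] term j k x
    ≡⟨ ∑-comm (λ j x → ∑[ k < N ] term j k x) ⟩
  ∑[ x < n ] ∑[ j < N ] ∑[ k < N ] term j k x
    ≡⟨ sum-cong-≗ (λ x →
         crossing-contribution m (lab λ′ (cOut x over)) (lab λ′ (cOut x under)) (sign D x)) ⟩
  crossingCut D (colourOf λ′ E) ∎
  where
  open ≡-Reasoning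
  m : Fin N → Bool
  m = member E
  link : Fin N → Fin N → Fin n → ℤ
  link j k x = if (eqF (lab λ′ (cOut x over)) j ∧ eqF (lab λ′ (cOut x under)) k)
                ∨ (eqF (lab λ′ (cOut x over)) k ∧ eqF (lab λ′ (cOut x under)) j) then sign D x else + 0
  term : Fin N → Fin N → Fin n → ℤ
  term j k x = if m j ∧ not (m k) then link j k x else + 0
  entry : Fin N → Fin N → ℤ
  entry j k = if m j ∧ not (m k) then lk D λ′ j k else + 0
  weighted : ∀ j k → entry j k ≡ ∑[ x < n ] term j k x
  weighted j k = trans (cong (λ v → if m j ∧ not (m k) then v else + 0) (sumℤ≡∑ (link j k)))
                       (∑-if (m j ∧ not (m k)) (link j k))

-- Subsets of labels

open FiniteSum ℤP.+-0-commutativeMonoid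

member-tabulate : ∀ {N} (g : Fin N → Bool) → member (tabulate g) ≗ g
member-tabulate g zero    = refl
member-tabulate g (suc j) = member-tabulate (g ∘ suc) j

member-map : ∀ {N} (h : Bool → Bool) (v : Vec Bool N) → member (map h v) ≗ h ∘ member v
member-map h (b ∷ v) zero    = refl
member-map h (b ∷ v) (suc j) = member-map h v j

member-injective : ∀ {N} {u v : Vec Bool N} → member u ≗ member v → u ≡ v
member-injective {u = []}    {[]}    _     = refl
member-injective {u = a ∷ u} {b ∷ v} u≗v = cong₂ _∷_ (u≗v zero) (member-injective (u≗v ∘ suc))

complement-involutive : ∀ {N} (v : Vec Bool N) → map not (map not v) ≡ v
complement-involutive []      = refl
complement-involutive (b ∷ v) = cong₂ _∷_ (not-involutive b) (complement-involutive v)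

invariant-reach : ∀ {n ℓ} {A : Set} {D : Diagram n ℓ} {c : Out n → A} → ArcInvariant D c →
  ∀ {o o′} → Reach D o o′ → c o′ ≡ c o
invariant-reach {D = D} {c} invariant (k , refl) = along k
  where
  along : ∀ k {o} → c (iter (succA D) k o) ≡ c o
  along zero    = refl
  along (suc k) = trans (invariant _) (along k)

colourOf-invariant : ∀ {n ℓ N} {D : Diagram n ℓ} (λ′ : Labelling D N) E → ArcInvariant D (colourOf λ′ E)
colourOf-invariant λ′ E o = cong (member E) (lab-succ λ′ o)

crossingCut-cong : ∀ {n ℓ} (D : Diagram n ℓ) {c c′ : Out n → Bool} →
  c ≗ c′ → crossingCut D c ≡ crossingCut D c′
crossingCut-cong D c≗c′ = sum-cong-≗ λ x →
  cong₂ (λ a b → if a xor b then sign D x else + 0) (c≗c′ (cOut x over)) (c≗c′ (cOut x under))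

cut-complement : ∀ {n ℓ N} (D : Diagram n ℓ) (λ′ : Labelling D N) E →
  cut D λ′ (map not E) ≡ cut D λ′ E
cut-complement D λ′ E = begin
  cut D λ′ (map not E)                    ≡⟨ cut-crossingCut D λ′ (map not E) ⟩
  crossingCut D (colourOf λ′ (map not E)) ≡⟨ crossingCut-cong D (λ o → member-map not E (lab λ′ o)) ⟩
  crossingCut D (not ∘ colourOf λ′ E)
    ≡⟨ sum-cong-≗ (λ x → cong (λ b → if b then sign D x else + 0)
         (xor-annihilates-not (colourOf λ′ E (cOut x over)) (colourOf λ′ E (cOut x under)))) ⟩
  crossingCut D (colourOf λ′ E)           ≡⟨ sym (cut-crossingCut D λ′ E) ⟩
  cut D λ′ E                              ∎
  where
  open ≡-Reasoning

module _ {n ℓ N} {L L′ : Diagram n ℓ} (λL : Labelling L N) (λL′ : Labelling L′ N) (E : Vec Bool N) where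

  transferredColour : ∀ {j} → (∃ λ o → lab λL′ o ≡ j) ⊎ (∃ λ l → loopLab λL′ l ≡ j) → Bool
  transferredColour (inj₁ (o , _)) = mutateColouring L (colourOf λL E) o
  transferredColour (inj₂ (l , _)) = member E (loopLab λL l)

  transfer : Vec Bool N
  transfer = tabulate (λ j → transferredColour (onto λL′ j))

module _ {n ℓ N} {L L′ : Diagram n ℓ} (mutant : IsMutant L L′)
         (λL : Labelling L N) (λL′ : Labelling L′ N) where

  transfer-ends : ∀ E o → member (transfer λL λL′ E) (lab λL′ o) ≡ mutateColouring L (colourOf λL E) o
  transfer-ends E o = trans (member-tabulate _ (lab λL′ o)) (pick (onto λL′ (lab λL′ o)))
    where
    pick : (r : (∃ λ o′ → lab λL′ o′ ≡ lab λL′ o) ⊎ (∃ λ l → loopLab λL′ l ≡ lab λL′ o)) →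
      transferredColour λL λL′ E r ≡ mutateColouring L (colourOf λL E) o
    pick (inj₁ (o′ , same)) =
      sym (invariant-reach {D = L′} (mutateColouring-invariant mutant (colourOf-invariant λL E))
                                    (lab-comp λL′ o′ o same))
    pick (inj₂ (l , same))  = ⊥-elim (loop-new λL′ l o same)

  transfer-loops : ∀ E l → member (transfer λL λL′ E) (loopLab λL′ l) ≡ member E (loopLab λL l)
  transfer-loops E l = trans (member-tabulate _ (loopLab λL′ l)) (pick (onto λL′ (loopLab λL′ l)))
    where
    pick : (r : (∃ λ o → lab λL′ o ≡ loopLab λL′ l) ⊎
                (∃ λ l′ → loopLab λL′ l′ ≡ loopLab λL′ l)) →
      transferredColour λL λL′ E r ≡ member E (loopLab λL l)
    pick (inj₁ (o , same))  = ⊥-elim (loop-new λL′ l o (sym same))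
    pick (inj₂ (l′ , same)) = cong (member E ∘ loopLab λL) (loop-inj λL′ l′ l same)

  transfer-cut : ∀ E → cut L′ λL′ (transfer λL λL′ E) ≡ cut L λL E
  transfer-cut E = begin
    cut L′ λL′ (transfer λL λL′ E)                ≡⟨ cut-crossingCut L′ λL′ (transfer λL λL′ E) ⟩
    crossingCut L′ (colourOf λL′ (transfer λL λL′ E)) ≡⟨ crossingCut-cong L′ (transfer-ends E) ⟩
    crossingCut L′ (mutateColouring L (colourOf λL E)) ≡⟨ crossingCut-mutate mutant (colourOf λL E) ⟩
    crossingCut L (colourOf λL E)                 ≡⟨ sym (cut-crossingCut L λL E) ⟩
    cut L λL E                                    ∎
    where open ≡-Reasoning

transfer-inverse : ∀ {n ℓ N} {L L′ : Diagram n ℓ} → IsMutant L L′ →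
  (λL : Labelling L N) (λL′ : Labelling L′ N) →
  ∀ E → transfer λL′ λL (transfer λL λL′ E) ≡ E
transfer-inverse mutant λL λL′ E = member-injective λ j → agree j (onto λL j)
  where
  agree : ∀ j → (∃ λ o → lab λL o ≡ j) ⊎ (∃ λ l → loopLab λL l ≡ j) →
    member (transfer λL′ λL (transfer λL λL′ E)) j ≡ member E j
  agree _ (inj₁ (o , refl)) = trans (transfer-ends (mutant-sym mutant) λL′ λL (transfer λL λL′ E) o)
    (mutateColouring-involutive mutant (colourOf-invariant λL E) (transfer-ends mutant λL λL′ E) o)
  agree _ (inj₂ (l , refl)) = trans (transfer-loops (mutant-sym mutant) λL′ λL (transfer λL λL′ E) l)
    (transfer-loops mutant λL λL′ E l)

head-split : ∀ {N} → Vec Bool (suc N) ↔ (Vec Bool N ⊎ Vec Bool N)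
head-split = mk↔ₛ′ (λ { (true ∷ v) → inj₁ v ; (false ∷ v) → inj₂ v })
                   (λ { (inj₁ v) → true ∷ v ; (inj₂ v) → false ∷ v })
                   (λ { (inj₁ v) → refl ; (inj₂ v) → refl })
                   (λ { (true ∷ v) → refl ; (false ∷ v) → refl })

subsets : ∀ N → Enumeration (Vec Bool N)
subsets zero    = via (mk↔ₛ′ (λ _ → zero) (λ _ → []) (λ { zero → refl }) (λ { [] → refl })) (finᵉ 1)
subsets (suc N) = via head-split (subsets N ⊎ᵉ subsets N)

Σ-subsets : ∀ N (h : Vec Bool (suc N) → ℤ) →
  Σ⟨ subsets (suc N) ⟩ h ≡ Σ⟨ subsets N ⟩ (h ∘ (true ∷_)) + Σ⟨ subsets N ⟩ (h ∘ (false ∷_))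
Σ-subsets N h = Σ-⊎ (subsets N) (subsets N) (h ∘ Inverse.from head-split)

sumSubsets-Σ : ∀ N (g : Vec Bool N → LPoly) m → sumSubsets N g m ≡ Σ⟨ subsets N ⟩ (λ E → g E m)
sumSubsets-Σ zero    g m = sym (ℤP.+-identityʳ (g [] m))
sumSubsets-Σ (suc N) g m =
  trans (cong₂ _+_ (sumSubsets-Σ N (g ∘ (true ∷_)) m) (sumSubsets-Σ N (g ∘ (false ∷_)) m))
  (sym (Σ-subsets N (λ E → g E m)))

sumSubsets-zero : ∀ N m → sumSubsets N (λ _ → 0ₚ) m ≡ + 0
sumSubsets-zero zero    m = refl
sumSubsets-zero (suc N) m = cong₂ _+_ (sumSubsets-zero N m) (sumSubsets-zero N m)

total : ∀ {n ℓ N} (D : Diagram n ℓ) → Labelling D N → ℤ → ℤ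
total {N = N} D λ′ m = Σ⟨ subsets N ⟩ (λ E → (γ^ cut D λ′ E) m)

total-halves : ∀ {n ℓ N} (D : Diagram n ℓ) (λ′ : Labelling D (suc N)) m →
  total D λ′ m ≡ f D λ′ m + f D λ′ m
total-halves {N = N} D λ′ m = begin
  total D λ′ m                            ≡⟨ Σ-subsets N term ⟩
  Σ⟨ subsets N ⟩ (term ∘ (true ∷_)) + half
    ≡⟨ cong (_+ half) (trans (Σ-cong (subsets N) complement)
                             (Σ-permute (subsets N) negation (term ∘ (false ∷_)))) ⟩
  half + half                             ≡⟨ sym (cong₂ _+_ f≡half f≡half) ⟩
  f D λ′ m + f D λ′ m                     ∎
  where
  open ≡-Reasoning
  term : Vec Bool (suc N) → ℤ
  term E = (γ^ cut D λ′ E) m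
  half : ℤ
  half = Σ⟨ subsets N ⟩ (term ∘ (false ∷_))
  complement : ∀ E → term (true ∷ E) ≡ term (false ∷ map not E)
  complement E = cong (λ k → (γ^ k) m) (sym (cut-complement D λ′ (true ∷ E)))
  negation : Vec Bool N ↔ Vec Bool N
  negation = mk↔ₛ′ (map not) (map not) complement-involutive complement-involutive
  f≡half : f D λ′ m ≡ half
  f≡half = trans (cong₂ _+_ (sumSubsets-zero N m) (sumSubsets-Σ N (λ E → γ^ cut D λ′ (false ∷ E)) m))
                 (ℤP.+-identityˡ half)

total-mutant : ∀ {n ℓ N} {L L′ : Diagram n ℓ} → IsMutant L L′ →
  (λL : Labelling L N) (λL′ : Labelling L′ N) →
  ∀ m → total L λL m ≡ total L′ λL′ m
total-mutant {N = N} {L} {L′} mutant λL λL′ m = begin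
  total L λL m
    ≡⟨ Σ-cong (subsets N) (λ E → cong (λ k → (γ^ k) m) (sym (transfer-cut mutant λL λL′ E))) ⟩
  Σ⟨ subsets N ⟩ (λ E → (γ^ cut L′ λL′ (transfer λL λL′ E)) m)
    ≡⟨ Σ-permute (subsets N) transfer↔ (λ E → (γ^ cut L′ λL′ E) m) ⟩
  total L′ λL′ m
    ∎
  where
  open ≡-Reasoning
  transfer↔ : Vec Bool N ↔ Vec Bool N
  transfer↔ = mk↔ₛ′ (transfer λL λL′) (transfer λL′ λL)
    (transfer-inverse (mutant-sym mutant) λL′ λL) (transfer-inverse mutant λL λL′)

double-injective : ∀ {a b : ℤ} → a + a ≡ b + b → a ≡ b
double-injective {a} {b} eq = ℤP.*-cancelˡ-≡ (+ 2) a b (trans (double a) (trans eq (sym (double b))))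
  where
  double : ∀ x → + 2 * x ≡ x + x
  double x = trans (ℤP.*-distribʳ-+ x (+ 1) (+ 1)) (cong₂ _+_ (ℤP.*-identityˡ x) (ℤP.*-identityˡ x))

-- f does not depend on the labelling at all.
lemma6p8 : ∀ {n ℓ N} (L L' : Diagram n ℓ) → IsMutant L L' →
    (λL : Labelling L N) (λL' : Labelling L' N) → Induced L L' λL λL' →
    ∀ m → f L λL m ≡ f L' λL' m
lemma6p8 {N = zero}  L L′ mutant λL λL′ _ m = ⊥-elim (¬Fin0 (lab λL (bOut 0F)))
lemma6p8 {N = suc N} L L′ mutant λL λL′ _ m = double-injective (begin
  f L λL m + f L λL m       ≡⟨ sym (total-halves L λL m) ⟩
  total L λL m              ≡⟨ total-mutant mutant λL λL′ m ⟩
  total L′ λL′ m            ≡⟨ total-halves L′ λL′ m ⟩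
  f L′ λL′ m + f L′ λL′ m   ∎)
  where open ≡-Reasoning
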